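{- Fix an integer $k > 0$ and a sequence $(b_1, b_2, \ldots, b_k)$ of nonnegative integers. Then there exists $n \geq 0$ such that $b_i(n) = b_i$ for all $1 \leq i \leq k$ and $b_i(n) = 0$ for all $i > k$ if and only if for every $1 \leq i \leq k$ we have $b_i \leq i$ and \[ \sum_{j=i}^{k} b_j \equiv 0 \pmod{i}. \]
   Context: Tchoukaillon boards. For each $n \geq 0$ define a sequence $b(n) = (b_1(n), b_2(n), \ldots)$ of nonnegative integers recursively: $b(0)$ is the all-zero sequence; given $b(n)$, let $p(n) = \min\{j \geq 1 : b_j(n) = 0\}$ and set $b_i(n+1) = b_i(n)$ if $i > p(n)$, $b_i(n+1) = i$ if $i = p(n)$, and $b_i(n+1) = b_i(n) - 1$ if $i < p(n)$. Here $b_i(n)$ is the number of stones in bin $i$ of the unique winning Tchoukaillon board with $n$ stones in total. -}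

module Defs where

open import Data.Nat using (ℕ; zero; suc; _+_; _∸_)
open import Data.List using (List; []; _∷_)

-- A board is represented by a finite list [b_1, b_2, ..., b_m]; bins beyond
-- the list are 0.  `bin B i` is b_i (1-indexed); `bin B 0` is an unused 0.
bin : List ℕ → ℕ → ℕ
bin []       _             = 0
bin (x ∷ xs) zero          = 0
bin (x ∷ xs) (suc zero)    = x
bin (x ∷ xs) (suc (suc i)) = bin xs (suc i)

-- One step of the recursion, starting at bin index `i` (initially 1):
-- bins before the first empty bin p lose one stone, bin p gets p stones,
-- later bins are unchanged.
stepFrom : ℕ → List ℕ → List ℕ
stepFrom i []            = i ∷ []
stepFrom i (zero ∷ xs)   = i ∷ xs
stepFrom i (suc x ∷ xs)  = x ∷ stepFrom (suc i) xs

step : List ℕ → List ℕ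
step = stepFrom 1

board : ℕ → List ℕ
board zero    = []
board (suc n) = step (board n)

b : ℕ → ℕ → ℕ
b n i = bin (board n) i

open import Data.Vec using (Vec; []; _∷_)

-- tailSum v m = sum of the entries of v at 0-based positions ≥ m,
-- i.e. for v = (b_1..b_k) and m = i-1 this is  Σ_{j=i}^{k} b_j.
tailSum : {k : ℕ} → Vec ℕ k → ℕ → ℕ
tailSum []       _       = 0
tailSum (x ∷ xs) zero    = x + tailSum xs zero
tailSum (x ∷ xs) (suc m) = tailSum xs m

-- Call a board valid from offset i if its j-th list entry (bin i + j) holds at
-- most i + j stones and i + j divides the sum of the entries from j on.  The
-- proof shows that the boards b(n) are exactly the valid boards (offset 1):
--   * one step of the recursion keeps a board valid: bins only shrink or are
--     refilled to their bound, and every tail sum either stays or grows by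
--     exactly the index of its first bin;
--   * conversely, a valid board with stones has a "full" bin j (holding i + j
--     stones: the last nonempty bin is full by the divisibility condition), and
--     undoing the step at the first full bin gives a valid board with one stone
--     fewer, so induction on the number of stones reaches the empty board.
-- Boards are compared bin-wise (relation ≈), since trailing empty bins do not
-- matter.
module Submission where

open import Defs
open import Data.Nat using (ℕ; zero; suc; _+_; _≤_; _<_)
open import Data.Nat.Divisibility using (_∣_)
open import Data.Fin using (Fin; toℕ)
open import Data.Vec using (Vec; lookup)
open import Data.Product using (∃-syntax; _×_)
open import Function.Bundles using (_⇔_)
open import Relation.Binary.PropositionalEquality using (_≡_)

open import Data.Nat using (z≤n; s≤s; _≟_; _<?_; >-nonZero)
open import Data.Nat.Properties
  using (+-identityʳ; +-suc; +-assoc; +-comm; suc-injective; m+n≡0⇒m≡0; m+n≡0⇒n≡0;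
         0≢1+n; ≤-refl; ≤-trans; ≤-antisym; n≤1+n; ≤∧≢⇒<; ≮⇒≥)
open import Data.Nat.Divisibility using (∣⇒≤; _∣0; ∣-refl; ∣m+n∣m⇒∣n; ∣m∣n⇒∣m+n)
open import Data.List using (List; []; _∷_; drop; length)
open import Data.Nat.ListAction using (sum)
open import Data.List.Properties using (drop-[]; drop-all)
open import Data.Vec using ([]; _∷_; toList)
open import Data.Vec.Properties using (length-toList)
open import Data.Fin using (fromℕ<) renaming (zero to fzero; suc to fsuc)
open import Data.Fin.Properties using (toℕ-fromℕ<)
open import Data.Product using (_,_; proj₁; proj₂)
open import Data.Sum using (_⊎_; inj₁; inj₂; map₂)
open import Relation.Nullary using (yes; no; contradiction)
open import Relation.Binary.PropositionalEquality using (refl; sym; trans; cong; cong₂; subst; subst₂; _≢_; module ≡-Reasoning)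
open import Function.Bundles using (mk⇔)

-- Boards as lists, indexed from 0: `at L j` is the content of the (j+1)-th
-- entry, and bins past the end of the list are empty.
at : List ℕ → ℕ → ℕ
at []       _       = 0
at (x ∷ xs) zero    = x
at (x ∷ xs) (suc j) = at xs j

bin-at : ∀ L j → bin L (suc j) ≡ at L j
bin-at []       j       = refl
bin-at (x ∷ xs) zero    = refl
bin-at (x ∷ xs) (suc j) = bin-at xs j

at-beyond : ∀ L j → length L ≤ j → at L j ≡ 0
at-beyond []       j       _       = refl
at-beyond (x ∷ xs) (suc j) (s≤s p) = at-beyond xs j p

at-drop : ∀ m L j → at (drop m L) j ≡ at L (m + j)
at-drop zero    L        j = refl
at-drop (suc m) []       j = refl
at-drop (suc m) (x ∷ xs) j = at-drop m xs j

-- Two boards are equal bin by bin (they may differ by trailing empty bins).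
_≈_ : List ℕ → List ℕ → Set
L ≈ M = ∀ j → at L j ≡ at M j

≈-drop : ∀ m {L M} → L ≈ M → drop m L ≈ drop m M
≈-drop m {L} {M} h j = trans (at-drop m L j) (trans (h (m + j)) (sym (at-drop m M j)))

≈-sum : ∀ L M → L ≈ M → sum L ≡ sum M
≈-sum []       []       h = refl
≈-sum []       (y ∷ ys) h = cong₂ _+_ (h 0) (≈-sum [] ys (λ j → h (suc j)))
≈-sum (x ∷ xs) []       h = cong₂ _+_ (h 0) (≈-sum xs [] (λ j → h (suc j)))
≈-sum (x ∷ xs) (y ∷ ys) h = cong₂ _+_ (h 0) (≈-sum xs ys (λ j → h (suc j)))

sum≡0⇒[]≈ : ∀ L → sum L ≡ 0 → [] ≈ L
sum≡0⇒[]≈ []       e j       = refl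
sum≡0⇒[]≈ (x ∷ xs) e zero    = sym (m+n≡0⇒m≡0 x e)
sum≡0⇒[]≈ (x ∷ xs) e (suc j) = sum≡0⇒[]≈ xs (m+n≡0⇒n≡0 x e) j

stepFrom-resp-≈ : ∀ i L M → L ≈ M → stepFrom i L ≈ stepFrom i M
stepFrom-resp-≈ i []           []           h j       = refl
stepFrom-resp-≈ i []           (zero ∷ ys)  h zero    = refl
stepFrom-resp-≈ i []           (zero ∷ ys)  h (suc j) = h (suc j)
stepFrom-resp-≈ i (zero ∷ xs)  []           h zero    = refl
stepFrom-resp-≈ i (zero ∷ xs)  []           h (suc j) = h (suc j)
stepFrom-resp-≈ i (zero ∷ xs)  (zero ∷ ys)  h zero    = refl
stepFrom-resp-≈ i (zero ∷ xs)  (zero ∷ ys)  h (suc j) = h (suc j)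
stepFrom-resp-≈ i (suc x ∷ xs) (suc y ∷ ys) h zero    = suc-injective (h 0)
stepFrom-resp-≈ i (suc x ∷ xs) (suc y ∷ ys) h (suc j) =
  stepFrom-resp-≈ (suc i) xs ys (λ j → h (suc j)) j
stepFrom-resp-≈ i []           (suc y ∷ ys) h j = contradiction (h 0) 0≢1+n
stepFrom-resp-≈ i (zero ∷ xs)  (suc y ∷ ys) h j = contradiction (h 0) 0≢1+n
stepFrom-resp-≈ i (suc x ∷ xs) []           h j = contradiction (sym (h 0)) 0≢1+n
stepFrom-resp-≈ i (suc x ∷ xs) (zero ∷ ys)  h j = contradiction (sym (h 0)) 0≢1+n

-- Validity from offset i: the list describes bins i, i+1, ...; bin i + j
-- holds at most i + j stones, and i + j divides the stones from it onwards.
Bounded : ℕ → List ℕ → Set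
Bounded i L = ∀ j → at L j ≤ i + j

Divisible : ℕ → List ℕ → Set
Divisible i L = ∀ j → (i + j) ∣ sum (drop j L)

Valid : ℕ → List ℕ → Set
Valid i L = Bounded i L × Divisible i L

valid-resp-≈ : ∀ {i L M} → L ≈ M → Valid i L → Valid i M
valid-resp-≈ {i} {L} {M} h (bounded , divisible) =
  (λ j → subst (_≤ i + j) (h j) (bounded j)) ,
  (λ j → subst ((i + j) ∣_) (≈-sum (drop j L) (drop j M) (≈-drop j h)) (divisible j))

head-bound : ∀ {i x xs} → Bounded i (x ∷ xs) → x ≤ i
head-bound {i} {x} h = subst (x ≤_) (+-identityʳ i) (h 0)

tail-bounded : ∀ {i x xs} → Bounded i (x ∷ xs) → Bounded (suc i) xs
tail-bounded {i} {xs = xs} h j = subst (at xs j ≤_) (+-suc i j) (h (suc j))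

cons-bounded : ∀ {i x xs} → x ≤ i → Bounded (suc i) xs → Bounded i (x ∷ xs)
cons-bounded {i} {x} hx h zero = subst (x ≤_) (sym (+-identityʳ i)) hx
cons-bounded {i} {xs = xs} hx h (suc j) = subst (at xs j ≤_) (sym (+-suc i j)) (h j)

tail-valid : ∀ {i x xs} → Valid i (x ∷ xs) → Valid (suc i) xs
tail-valid {i} {xs = xs} (bounded , divisible) =
  tail-bounded bounded ,
  (λ j → subst (_∣ sum (drop j xs)) (+-suc i j) (divisible (suc j)))

stepFrom-sum : ∀ i L → sum (stepFrom i L) ≡ sum L + i
stepFrom-sum i []           = +-identityʳ i
stepFrom-sum i (zero ∷ xs)  = +-comm i (sum xs)
stepFrom-sum i (suc x ∷ xs) = begin
  x + sum (stepFrom (suc i) xs) ≡⟨ cong (x +_) (stepFrom-sum (suc i) xs) ⟩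
  x + (sum xs + suc i)          ≡⟨ sym (+-assoc x (sum xs) (suc i)) ⟩
  x + sum xs + suc i            ≡⟨ +-suc (x + sum xs) i ⟩
  suc (x + sum xs + i)          ∎
  where open ≡-Reasoning

GrowsBy : ℕ → ℕ → ℕ → Set
GrowsBy d m n = n ≡ m ⊎ n ≡ m + d

∣-grow : ∀ {d m n} → GrowsBy d m n → d ∣ m → d ∣ n
∣-grow (inj₁ refl) h = h
∣-grow (inj₂ refl) h = ∣m∣n⇒∣m+n h ∣-refl

∣-shrink : ∀ {d m n} → GrowsBy d m n → d ∣ n → d ∣ m
∣-shrink         (inj₁ refl) h = h
∣-shrink {d} {m} (inj₂ refl) h = ∣m+n∣m⇒∣n (subst (d ∣_) (+-comm m d) h) ∣-refl

-- The stones from bin i + j on grow by i + j (when the step fills a bin at or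
-- after it) or stay the same (when the filled bin comes before it).
stepFrom-tailSum : ∀ i L j → GrowsBy (i + j) (sum (drop j L)) (sum (drop j (stepFrom i L)))
stepFrom-tailSum i L            zero    =
  inj₂ (trans (stepFrom-sum i L) (cong (sum L +_) (sym (+-identityʳ i))))
stepFrom-tailSum i []           (suc j) = inj₁ (cong sum (drop-[] j))
stepFrom-tailSum i (zero ∷ xs)  (suc j) = inj₁ refl
stepFrom-tailSum i (suc x ∷ xs) (suc j) =
  map₂ (λ e → trans e (cong (sum (drop j xs) +_) (sym (+-suc i j))))
       (stepFrom-tailSum (suc i) xs j)

-- Bins before the filled one lose a stone, the filled one reaches its bound.
stepFrom-bounded : ∀ i L → Bounded i L → Bounded i (stepFrom i L)
stepFrom-bounded i []           h = cons-bounded ≤-refl (λ _ → z≤n)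
stepFrom-bounded i (zero ∷ xs)  h = cons-bounded ≤-refl (tail-bounded h)
stepFrom-bounded i (suc x ∷ xs) h =
  cons-bounded (≤-trans (n≤1+n x) (head-bound h)) (stepFrom-bounded (suc i) xs (tail-bounded h))

stepFrom-valid : ∀ i L → Valid i L → Valid i (stepFrom i L)
stepFrom-valid i L (bounded , divisible) =
  stepFrom-bounded i L bounded , λ j → ∣-grow (stepFrom-tailSum i L j) (divisible j)

board-valid : ∀ n → Valid 1 (board n)
board-valid zero    = (λ _ → z≤n) , λ j → subst (λ l → suc j ∣ sum l) (sym (drop-[] j)) (suc j ∣0)
board-valid (suc n) = stepFrom-valid 1 (board n) (board-valid n)

Full : ℕ → List ℕ → Set
Full i L = ∃[ j ] at L j ≡ i + j

full-tail : ∀ {i x xs} → x ≢ i → Full i (x ∷ xs) → Full (suc i) xs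
full-tail {i} x≢i (zero  , e) = contradiction (trans e (+-identityʳ i)) x≢i
full-tail {i} x≢i (suc j , e) = j , trans e (+-suc i j)

positive-multiple-≤ : ∀ {x i} → 0 < x → x ≤ i → i ∣ x → x ≡ i
positive-multiple-≤ 0<x x≤i i∣x = ≤-antisym x≤i (∣⇒≤ {{>-nonZero 0<x}} i∣x)

-- A valid board with stones has a full bin: its last nonempty bin.
full-bin : ∀ i L → Valid i L → 0 < sum L → Full i L
full-bin i (x ∷ xs) V pos with sum xs in eq
... | suc _ with full-bin (suc i) xs (tail-valid V) (subst (0 <_) (sym eq) (s≤s z≤n))
...   | j , e = suc j , trans e (sym (+-suc i j))
full-bin i (x ∷ xs) V pos | zero =
  0 , trans (positive-multiple-≤ 0<x (head-bound (proj₁ V)) i∣x) (sym (+-identityʳ i))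
  where
  x+sum≡x : x + sum xs ≡ x
  x+sum≡x = trans (cong (x +_) eq) (+-identityʳ x)
  0<x : 0 < x
  0<x = subst (0 <_) (+-identityʳ x) pos
  i∣x : i ∣ x
  i∣x = subst₂ _∣_ (+-identityʳ i) x+sum≡x (proj₂ V 0)

unstepFrom : ℕ → List ℕ → List ℕ
unstepFrom i []       = []
unstepFrom i (x ∷ xs) with x ≟ i
... | yes _ = 0 ∷ xs
... | no  _ = suc x ∷ unstepFrom (suc i) xs

-- For a board with a full bin, stepping undoes the unstep (offset ≥ 1, since
-- a step always fills a bin with a positive number of stones).
stepFrom-unstepFrom : ∀ i L → Full (suc i) L → stepFrom (suc i) (unstepFrom (suc i) L) ≡ L
stepFrom-unstepFrom i []       (j , ())
stepFrom-unstepFrom i (x ∷ xs) F with x ≟ suc i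
... | yes x≡1+i = cong (_∷ xs) (sym x≡1+i)
... | no  x≢1+i = cong (x ∷_) (stepFrom-unstepFrom (suc i) xs (full-tail x≢1+i F))

-- The bins before the first full one are below their bound, so the unstep
-- keeps the board bounded.
unstepFrom-bounded : ∀ i L → Bounded i L → Bounded i (unstepFrom i L)
unstepFrom-bounded i []       h = λ _ → z≤n
unstepFrom-bounded i (x ∷ xs) h with x ≟ i
... | yes _   = cons-bounded z≤n (tail-bounded h)
... | no  x≢i = cons-bounded (≤∧≢⇒< (head-bound h) x≢i) (unstepFrom-bounded (suc i) xs (tail-bounded h))

unstepFrom-valid : ∀ i L → Full (suc i) L → Valid (suc i) L → Valid (suc i) (unstepFrom (suc i) L)
unstepFrom-valid i L F (bounded , divisible) =
  unstepFrom-bounded (suc i) L bounded , divisible′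
  where
  L′ = unstepFrom (suc i) L
  divisible′ : Divisible (suc i) L′
  divisible′ j = ∣-shrink (subst (GrowsBy _ _) (cong (λ l → sum (drop j l)) (stepFrom-unstepFrom i L F))
                                 (stepFrom-tailSum (suc i) L′ j))
                          (divisible j)

unstepFrom-sum : ∀ i L → Full (suc i) L → sum (unstepFrom (suc i) L) + suc i ≡ sum L
unstepFrom-sum i L F = trans (sym (stepFrom-sum (suc i) (unstepFrom (suc i) L)))
                             (cong sum (stepFrom-unstepFrom i L F))

valid⇒board : ∀ L → Valid 1 L → ∃[ n ] board n ≈ L
valid⇒board L = induct (sum L) L refl
  where
  induct : ∀ s L → sum L ≡ s → Valid 1 L → ∃[ n ] board n ≈ L
  induct zero    L e V = 0 , sum≡0⇒[]≈ L e
  induct (suc s) L e V with full-bin 1 L V (subst (0 <_) (sym e) (s≤s z≤n))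
  ... | F with induct s (unstepFrom 1 L)
                 (suc-injective (trans (+-comm 1 _) (trans (unstepFrom-sum 0 L F) e)))
                 (unstepFrom-valid 0 L F V)
  ...   | n , h = suc n , subst (board (suc n) ≈_) (stepFrom-unstepFrom 0 L F)
                                (stepFrom-resp-≈ 1 (board n) (unstepFrom 1 L) h)

at-toList : ∀ {k} (v : Vec ℕ k) (i : Fin k) → at (toList v) (toℕ i) ≡ lookup v i
at-toList (x ∷ v) fzero    = refl
at-toList (x ∷ v) (fsuc i) = at-toList v i

length-toList-≤ : ∀ {k j} (v : Vec ℕ k) → k ≤ j → length (toList v) ≤ j
length-toList-≤ {j = j} v k≤j = subst (_≤ j) (sym (length-toList v)) k≤j

tailSum-toList : ∀ {k} (v : Vec ℕ k) m → tailSum v m ≡ sum (drop m (toList v))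
tailSum-toList []      m       = sym (cong sum (drop-[] m))
tailSum-toList (x ∷ v) zero    = cong (x +_) (tailSum-toList v zero)
tailSum-toList (x ∷ v) (suc m) = tailSum-toList v m

data Position (k : ℕ) : ℕ → Set where
  inside  : (i : Fin k) → Position k (toℕ i)
  outside : ∀ {j} → k ≤ j → Position k j

position : ∀ k j → Position k j
position k j with j <? k
... | yes j<k = subst (Position k) (toℕ-fromℕ< j<k) (inside (fromℕ< j<k))
... | no  j≮k = outside (≮⇒≥ j≮k)

Matches : ∀ {k} → List ℕ → Vec ℕ k → Set
Matches {k} L v = ((i : Fin k) → bin L (suc (toℕ i)) ≡ lookup v i) × ((i : ℕ) → k < i → bin L i ≡ 0)

Conditions : ∀ {k} → Vec ℕ k → Set
Conditions {k} v = (i : Fin k) → (lookup v i ≤ suc (toℕ i)) × (suc (toℕ i) ∣ tailSum v (toℕ i))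

matches⇒≈ : ∀ {k} L (v : Vec ℕ k) → Matches L v → L ≈ toList v
matches⇒≈ {k} L v (agree , empty) j with position k j
... | inside i    = trans (sym (bin-at L (toℕ i))) (trans (agree i) (sym (at-toList v i)))
... | outside k≤j = trans (sym (bin-at L j))
                          (trans (empty (suc j) (s≤s k≤j)) (sym (at-beyond (toList v) j (length-toList-≤ v k≤j))))

≈⇒matches : ∀ {k} L (v : Vec ℕ k) → L ≈ toList v → Matches L v
≈⇒matches {k} L v h = (λ i → trans (bin-at L (toℕ i)) (trans (h (toℕ i)) (at-toList v i))) , empty
  where
  empty : (i : ℕ) → k < i → bin L i ≡ 0
  empty (suc j) (s≤s k≤j) = trans (bin-at L j) (trans (h j) (at-beyond (toList v) j (length-toList-≤ v k≤j)))

valid⇒conditions : ∀ {k} (v : Vec ℕ k) → Valid 1 (toList v) → Conditions v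
valid⇒conditions v (bounded , divisible) i =
  subst (_≤ suc (toℕ i)) (at-toList v i) (bounded (toℕ i)) ,
  subst (suc (toℕ i) ∣_) (sym (tailSum-toList v (toℕ i))) (divisible (toℕ i))

conditions⇒valid : ∀ {k} (v : Vec ℕ k) → Conditions v → Valid 1 (toList v)
conditions⇒valid {k} v c = bounded , divisible
  where
  bounded : Bounded 1 (toList v)
  bounded j with position k j
  ... | inside i    = subst (_≤ suc (toℕ i)) (sym (at-toList v i)) (proj₁ (c i))
  ... | outside k≤j = subst (_≤ suc j) (sym (at-beyond (toList v) j (length-toList-≤ v k≤j))) z≤n
  divisible : Divisible 1 (toList v)
  divisible j with position k j
  ... | inside i    = subst (suc (toℕ i) ∣_) (tailSum-toList v (toℕ i)) (proj₂ (c i))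
  ... | outside k≤j = subst (λ l → suc j ∣ sum l) (sym (drop-all j (toList v) (length-toList-≤ v k≤j))) (suc j ∣0)

theorem3p2 : (k : ℕ) → 0 < k → (v : Vec ℕ k) →
    (∃[ n ] (((i : Fin k) → b n (suc (toℕ i)) ≡ lookup v i) × ((i : ℕ) → k < i → b n i ≡ 0)))
    ⇔ ((i : Fin k) → (lookup v i ≤ suc (toℕ i)) × (suc (toℕ i) ∣ tailSum v (toℕ i)))
theorem3p2 k _ v = mk⇔ necessary sufficient
  where
  necessary : ∃[ n ] Matches (board n) v → Conditions v
  necessary (n , m) = valid⇒conditions v (valid-resp-≈ (matches⇒≈ (board n) v m) (board-valid n))
  sufficient : Conditions v → ∃[ n ] Matches (board n) v
  sufficient c with valid⇒board (toList v) (conditions⇒valid v c)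
  ... | n , board≈v = n , ≈⇒matches (board n) v board≈v
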